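{- Let $G$ be a factored graph and suppose a vertex $v\in V(G)$ belongs to factored components $G_F$ and $G_{F'}$ of $G$. Then $\dim(G_F)=\dim(G_{F'})$.
   Context: All graphs are directed. Graph operations: Cartesian product $G\,\square\,H$ (vertex set $V(G)\times V(H)$, edge $((v_1,u_1),(v_2,u_2))$ iff $v_1=v_2$ and $(u_1,u_2)\in E(H)$, or $u_1=u_2$ and $(v_1,v_2)\in E(G)$), tensor product $G\times H$ (vertex set $V(G)\times V(H)$, edge iff $(v_1,v_2)\in E(G)$ and $(u_1,u_2)\in E(H)$), and union $G\cup H$ (vertex set $V(G)\cup V(H)$, edge set $E(G)\cup E(H)$). Vertices of products are flattened tuples, so products are associative. A factored graph $G=f(G_1,\dots,G_m)$ is given by a formula $f$ built from input graphs using these operations and parentheses. Its tree structure is defined recursively: if $f$ is a single graph, the tree is a single leaf; if $f=H_1\circ\cdots\circ H_\ell$ for an operation $\circ\in\{\cup,\square,\times\}$, the root is labelled $\circ$ with $\ell$ children, the $i$-th being the tree structure of $H_i$. A factored component $G_F$ of $G$ is a factored graph whose tree structure is obtained from that of $G$ by recursively replacing each internal union node with the subtree rooted at one of its children. If the tree of $G_F$ has $\ell$ leaves, every vertex of $G_F$ is a tuple $(v_1,\dots,v_\ell)$ with $v_i$ a vertex of the $i$-th leaf graph, and $\dim(G_F)=\ell$. -}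

module Defs where

open import Data.Nat using (ℕ; _+_)
open import Data.Product using (_×_)
open import Data.List using (List; []; _∷_; _++_; [_])
open import Data.List.Membership.Propositional using (_∈_)
open import Data.List.Relation.Binary.Pointwise using (Pointwise)

record Graph (A : Set) : Set₁ where
  field
    V : A → Set
    E : A → A → Set
    E⊆V : ∀ {x y} → E x y → V x × V y
open Graph public

-- Formulas / tree structures of factored graphs.  An internal node is an
-- operation together with the ordered list of its children H₁ … H_ℓ.
data Formula (A : Set) : Set₁ where
  leaf  : Graph A → Formula A
  ∪[_]  : List (Formula A) → Formula A
  □[_]  : List (Formula A) → Formula A
  ×[_]  : List (Formula A) → Formula A

-- Vertices of the factored graph are flattened tuples, i.e. lists of atomic
-- vertices.  A vertex of an input graph is the 1-tuple [ x ].
mutual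
  data Vert {A : Set} : Formula A → List A → Set₁ where
    leafV : ∀ {G x} → V G x → Vert (leaf G) [ x ]
    unionV : ∀ {hs h v} → h ∈ hs → Vert h v → Vert ∪[ hs ] v
    cartV  : ∀ {hs v} → VertProd hs v → Vert □[ hs ] v
    tensV  : ∀ {hs v} → VertProd hs v → Vert ×[ hs ] v

  data VertProd {A : Set} : List (Formula A) → List A → Set₁ where
    []ᵥ  : VertProd [] []
    _∷ᵥ_ : ∀ {h hs u w} → Vert h u → VertProd hs w → VertProd (h ∷ hs) (u ++ w)

mutual
  data Edge {A : Set} : Formula A → List A → List A → Set₁ where
    leafE  : ∀ {G x y} → E G x y → Edge (leaf G) [ x ] [ y ]
    unionE : ∀ {hs h u w} → h ∈ hs → Edge h u w → Edge ∪[ hs ] u w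
    cartE  : ∀ {hs u w} → EdgeCart hs u w → Edge □[ hs ] u w
    tensE  : ∀ {hs u w} → EdgeTens hs u w → Edge ×[ hs ] u w

  data EdgeCart {A : Set} : List (Formula A) → List A → List A → Set₁ where
    here  : ∀ {h hs u u' w} → Edge h u u' → VertProd hs w →
            EdgeCart (h ∷ hs) (u ++ w) (u' ++ w)
    there : ∀ {h hs u w w'} → Vert h u → EdgeCart hs w w' →
            EdgeCart (h ∷ hs) (u ++ w) (u ++ w')

  data EdgeTens {A : Set} : List (Formula A) → List A → List A → Set₁ where
    []ₑ  : EdgeTens [] [] []
    _∷ₑ_ : ∀ {h hs u u' w w'} → Edge h u u' → EdgeTens hs w w' →
           EdgeTens (h ∷ hs) (u ++ w) (u' ++ w')

data IsComponent {A : Set} : Formula A → Formula A → Set₁ where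
  leafC  : ∀ {G} → IsComponent (leaf G) (leaf G)
  unionC : ∀ {hs h F} → h ∈ hs → IsComponent h F → IsComponent ∪[ hs ] F
  cartC  : ∀ {hs fs} → Pointwise IsComponent hs fs → IsComponent □[ hs ] □[ fs ]
  tensC  : ∀ {hs fs} → Pointwise IsComponent hs fs → IsComponent ×[ hs ] ×[ fs ]

mutual
  dim : {A : Set} → Formula A → ℕ
  dim (leaf _) = 1
  dim ∪[ hs ] = dims hs
  dim □[ hs ] = dims hs
  dim ×[ hs ] = dims hs

  dims : {A : Set} → List (Formula A) → ℕ
  dims [] = 0
  dims (h ∷ hs) = dim h + dims hs

{-# OPTIONS --safe #-}
module Submission where

-- A factored component contains no union node, and in a union-free formula
-- every leaf contributes exactly one coordinate to each vertex, so every
-- vertex is a tuple of length dim F. Hence the common vertex v has length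
-- dim F and dim F'.

open import Defs
open import Data.Nat using (_+_)
open import Data.List using (List; length)
open import Data.List.Properties using (length-++)
open import Data.List.Relation.Unary.All using (All; []; _∷_)
open import Data.List.Relation.Binary.Pointwise using (Pointwise; []; _∷_)
open import Relation.Binary.PropositionalEquality using (_≡_; refl; sym; trans; cong₂)

data UnionFree {A : Set} : Formula A → Set₁ where
  leaf : ∀ {G} → UnionFree (leaf G)
  □[_] : ∀ {hs} → All UnionFree hs → UnionFree □[ hs ]
  ×[_] : ∀ {hs} → All UnionFree hs → UnionFree ×[ hs ]

mutual
  component⇒unionFree : {A : Set} {G F : Formula A} → IsComponent G F → UnionFree F
  component⇒unionFree leafC        = leaf
  component⇒unionFree (unionC _ c) = component⇒unionFree c
  component⇒unionFree (cartC cs)   = □[ components⇒unionFree cs ]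
  component⇒unionFree (tensC cs)   = ×[ components⇒unionFree cs ]

  components⇒unionFree : {A : Set} {hs fs : List (Formula A)} →
                         Pointwise IsComponent hs fs → All UnionFree fs
  components⇒unionFree []       = []
  components⇒unionFree (c ∷ cs) = component⇒unionFree c ∷ components⇒unionFree cs

mutual
  length-vert : {A : Set} {F : Formula A} {v : List A} →
                UnionFree F → Vert F v → length v ≡ dim F
  length-vert leaf    (leafV _)  = refl
  length-vert □[ fs ] (cartV vs) = length-vertProd fs vs
  length-vert ×[ fs ] (tensV vs) = length-vertProd fs vs

  length-vertProd : {A : Set} {fs : List (Formula A)} {v : List A} →
                    All UnionFree fs → VertProd fs v → length v ≡ dims fs
  length-vertProd []       []ᵥ = refl
  length-vertProd (f ∷ fs) (_∷ᵥ_ {u = u} vu vw) =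
    trans (length-++ u) (cong₂ _+_ (length-vert f vu) (length-vertProd fs vw))

length-vert-component : {A : Set} {G F : Formula A} {v : List A} →
                        IsComponent G F → Vert F v → length v ≡ dim F
length-vert-component c = length-vert (component⇒unionFree c)

lemma2p7 : {A : Set} (G F F' : Formula A) (v : List A) →
           IsComponent G F → IsComponent G F' →
           Vert F v → Vert F' v → dim F ≡ dim F'
lemma2p7 G F F' v c c' vF vF' =
  trans (sym (length-vert-component c vF)) (length-vert-component c' vF')
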